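{- Let $n\geq 3$. There is no injective function $f\colon H_n^3\to H_n$ of behaviour majority, and there is no function $f\colon H_n^3\to H_n$ satisfying both type conditions $f(N,N,E)=E$ and $f(E,N,N)=E$.
   Context: $(H_n,E)$ ($n\geq3$) is the unique countable homogeneous graph whose finite induced subgraphs are exactly the finite $K_n$-free graphs; $N(x,y)$ means $\neg E(x,y)\wedge x\neq y$. For binary relations $R_1,R_2,R_3$ and $S$, the type condition $f(R_1,R_2,R_3)=S$ means: for all $p,q\in H_n^3$ with $R_i(p_i,q_i)$ for $i=1,2,3$, we have $S(f(p),f(q))$. A ternary injection $f$ has behaviour majority if for all $u,v\in H_n^3$ with $u_i\neq v_i$ for $i=1,2,3$, $E(f(u),f(v))$ holds iff $E(u_i,v_i)$ holds for at least two indices $i\in\{1,2,3\}$. -}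

module Defs where

open import Data.Nat using (ℕ)
open import Data.Fin using (Fin)
open import Data.Product using (Σ; _×_; _,_; ∃-syntax)
open import Data.Sum using (_⊎_)
open import Relation.Nullary using (¬_)
open import Relation.Binary.PropositionalEquality using (_≡_; _≢_)
open import Function.Bundles using (_⇔_)
open import Function.Definitions using (Injective; Inverseᵇ)

record Graph : Set₁ where
  field
    V     : Set
    E     : V → V → Set
    E-sym : ∀ {x y} → E x y → E y x
    E-irr : ∀ {x} → ¬ E x x
open Graph public

N : (G : Graph) → V G → V G → Set
N G x y = ¬ E G x y × x ≢ y

record FinGraph : Set₁ where
  field
    size  : ℕ
    R     : Fin size → Fin size → Set
    R-sym : ∀ {i j} → R i j → R j i
    R-irr : ∀ {i} → ¬ R i i
open FinGraph public

HasClique : ℕ → FinGraph → Set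
HasClique n F =
  Σ (Fin n → Fin (size F)) λ c → Injective _≡_ _≡_ c × (∀ i j → i ≢ j → R F (c i) (c j))

EmbedsInto : FinGraph → Graph → Set
EmbedsInto F G =
  Σ (Fin (size F) → V G) λ g → Injective _≡_ _≡_ g × (∀ i j → R F i j ⇔ E G (g i) (g j))

record Automorphism (G : Graph) : Set where
  field
    to      : V G → V G
    from    : V G → V G
    inverse : Inverseᵇ _≡_ _≡_ to from
    pres    : ∀ x y → E G x y ⇔ E G (to x) (to y)
open Automorphism public

-- Homogeneity: every isomorphism between finite induced subgraphs
-- (given as two injective tuples a, b inducing the same edges)
-- extends to an automorphism.
Homogeneous : Graph → Set
Homogeneous G =
  ∀ (k : ℕ) (a b : Fin k → V G) →
  Injective _≡_ _≡_ a → Injective _≡_ _≡_ b →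
  (∀ i j → E G (a i) (a j) ⇔ E G (b i) (b j)) →
  Σ (Automorphism G) λ σ → ∀ i → to σ (a i) ≡ b i

Countable : Set → Set
Countable A = Σ (A → ℕ) λ c → Injective _≡_ _≡_ c

-- G is (a copy of) the Henson graph H_n: countable, homogeneous, and its
-- finite induced subgraphs are (up to isomorphism) exactly the finite K_n-free graphs.
IsHenson : ℕ → Graph → Set₁
IsHenson n G =
  Countable (V G) × Homogeneous G ×
  (∀ (F : FinGraph) → EmbedsInto F G ⇔ (¬ HasClique n F))

Ternary : Graph → Set
Ternary G = V G → V G → V G → V G

Injective3 : (G : Graph) → Ternary G → Set
Injective3 G f = ∀ {x₁ x₂ x₃ y₁ y₂ y₃} → f x₁ x₂ x₃ ≡ f y₁ y₂ y₃ →
  (x₁ ≡ y₁) × (x₂ ≡ y₂) × (x₃ ≡ y₃)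

TypeCond : (G : Graph) → Ternary G → (R₁ R₂ R₃ S : V G → V G → Set) → Set
TypeCond G f R₁ R₂ R₃ S = ∀ p₁ p₂ p₃ q₁ q₂ q₃ →
  R₁ p₁ q₁ → R₂ p₂ q₂ → R₃ p₃ q₃ → S (f p₁ p₂ p₃) (f q₁ q₂ q₃)

AtLeastTwo : Set → Set → Set → Set
AtLeastTwo A B C = (A × B) ⊎ (A × C) ⊎ (B × C)

Majority : (G : Graph) → Ternary G → Set
Majority G f = ∀ u₁ u₂ u₃ v₁ v₂ v₃ → u₁ ≢ v₁ → u₂ ≢ v₂ → u₃ ≢ v₃ →
  E G (f u₁ u₂ u₃) (f v₁ v₂ v₃) ⇔ AtLeastTwo (E G u₁ v₁) (E G u₂ v₂) (E G u₃ v₃)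

module Submission where

open import Defs
open import Data.Nat using (ℕ; _≥_; _+_; s≤s)
open import Data.Nat.Properties using (n<1+n)
open import Data.Fin using (Fin; zero; suc; _≟_)
open import Data.Fin.Properties using (<⇒notInjective)
open import Data.Product using (Σ; _×_; _,_; proj₁; proj₂)
import Data.Product as Product
open import Data.Sum using (_⊎_; inj₁; inj₂)
import Data.Sum as Sum
open import Data.Unit using (⊤; tt)
open import Data.Empty using (⊥; ⊥-elim)
open import Relation.Nullary using (¬_; Dec; yes; no)
open import Relation.Binary.PropositionalEquality
  using (_≡_; _≢_; refl; sym; cong; subst; ≢-sym)
open import Function using (id; _∘_)
open import Function.Bundles using (mk⇔; Equivalence)
open import Function.Definitions using (Injective)
open import Function.Consequences.Propositional
  using (inverseʳ⇒injective; strictlyInverseʳ⇒inverseʳ)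

-- Both parts produce an n-clique in H_n, which cannot exist. The graph F = K_n minus the
-- edge {0,1} is K_n-free, so it embeds into H_n by some g. Under majority, precompose g
-- with the transpositions (0 2) and (1 2): a pair i ≠ j of Fin n is the non-edge {0,1} in
-- at most one of the three coordinates, so i ↦ f(g i, g (0 2)i, g (1 2)i) is a clique. For the type conditions, embed also the single edge
-- {0,1} by g₁ and the edgeless graph by g₂; then i ↦ f(g₁ i, g₂ i, g i) sends the pair
-- {0,1} to type (E,N,N) and every other pair to type (N,N,E), so again it is a clique.

AtLeastTwo-map : ∀ {A A′ B B′ C C′ : Set} → (A → A′) → (B → B′) → (C → C′) →
                 AtLeastTwo A B C → AtLeastTwo A′ B′ C′
AtLeastTwo-map f g h =
  Sum.map (Product.map f g) (Sum.map (Product.map f h) (Product.map g h))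

IsClique : (G : Graph) {k : ℕ} → (Fin k → V G) → Set
IsClique G h = ∀ i j → i ≢ j → E G (h i) (h j)

clique⇒injective : (G : Graph) {k : ℕ} {h : Fin k → V G} →
                   IsClique G h → Injective _≡_ _≡_ h
clique⇒injective G {h = h} clique {i} {j} hi≡hj with i ≟ j
... | yes i≡j = i≡j
... | no  i≢j = ⊥-elim (E-irr G (subst (E G (h i)) (sym hi≡hj) (clique i j i≢j)))

complete : ℕ → FinGraph
complete k = record { size = k ; R = _≢_ ; R-sym = ≢-sym ; R-irr = λ i≢i → i≢i refl }

complete-hasClique : ∀ k → HasClique k (complete k)
complete-hasClique k = id , id , λ _ _ i≢j → i≢j

Joins₀₁ : ∀ {k} → Fin k → Fin k → Set
Joins₀₁ zero       (suc zero) = ⊤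
Joins₀₁ (suc zero) zero       = ⊤
Joins₀₁ _          _          = ⊥

Joins₀₁? : ∀ {k} (i j : Fin k) → Dec (Joins₀₁ i j)
Joins₀₁? zero          zero          = no λ ()
Joins₀₁? zero          (suc zero)    = yes tt
Joins₀₁? zero          (suc (suc _)) = no λ ()
Joins₀₁? (suc zero)    zero          = yes tt
Joins₀₁? (suc zero)    (suc _)       = no λ ()
Joins₀₁? (suc (suc _)) _             = no λ ()

Joins₀₁-sym : ∀ {k} {i j : Fin k} → Joins₀₁ i j → Joins₀₁ j i
Joins₀₁-sym {i = zero}     {suc zero} tt = tt
Joins₀₁-sym {i = suc zero}   {zero}     tt = tt

Joins₀₁-irr : ∀ {k} {i : Fin k} → ¬ Joins₀₁ i i
Joins₀₁-irr {i = zero}        ()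
Joins₀₁-irr {i = suc zero}    ()
Joins₀₁-irr {i = suc (suc _)} ()

Joins₀₁-functional : ∀ {k} {i j j′ : Fin k} → Joins₀₁ i j → Joins₀₁ i j′ → j ≡ j′
Joins₀₁-functional {i = zero}     {suc zero} {suc zero} tt tt = refl
Joins₀₁-functional {i = suc zero} {zero}     {zero}     tt tt = refl

single-edge : ℕ → FinGraph
single-edge k = record
  { size = k ; R = Joins₀₁ ; R-sym = Joins₀₁-sym ; R-irr = Joins₀₁-irr }

co-single-edge : ℕ → FinGraph
co-single-edge k = record
  { size  = k
  ; R     = λ i j → i ≢ j × ¬ Joins₀₁ i j
  ; R-sym = Product.map ≢-sym (λ ¬ij ji → ¬ij (Joins₀₁-sym ji))
  ; R-irr = λ (i≢i , _) → i≢i refl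
  }

edgeless : ℕ → FinGraph
edgeless k = record { size = k ; R = λ _ _ → ⊥ ; R-sym = λ () ; R-irr = λ () }

edgeless-cliqueFree : ∀ {k m} → ¬ HasClique (2 + m) (edgeless k)
edgeless-cliqueFree (_ , _ , clique) = clique zero (suc zero) λ ()

single-edge-triangleFree : ∀ {k m} → ¬ HasClique (3 + m) (single-edge k)
single-edge-triangleFree (c , c-inj , clique)
  with c-inj (Joins₀₁-functional (clique zero (suc zero) λ ())
                                 (clique zero (suc (suc zero)) λ ()))
... | ()

merge₀₁ : ∀ {k} → Fin (2 + k) → Fin (1 + k)
merge₀₁ zero    = zero
merge₀₁ (suc i) = i

merge₀₁-fibres : ∀ {k} (i j : Fin (2 + k)) → merge₀₁ i ≡ merge₀₁ j → i ≡ j ⊎ Joins₀₁ i j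
merge₀₁-fibres zero       zero       _  = inj₁ refl
merge₀₁-fibres zero       (suc zero) _  = inj₂ tt
merge₀₁-fibres (suc zero) zero       _  = inj₂ tt
merge₀₁-fibres (suc i)    (suc j)    eq = inj₁ (cong suc eq)

co-single-edge-cliqueFree : ∀ k → ¬ HasClique (2 + k) (co-single-edge (2 + k))
co-single-edge-cliqueFree k (c , _ , clique) =
  <⇒notInjective (n<1+n (1 + k)) merged-injective
  where
  merged-injective : Injective _≡_ _≡_ (λ i → merge₀₁ (c i))
  merged-injective {i} {j} eq with i ≟ j
  ... | yes i≡j = i≡j
  ... | no  i≢j with merge₀₁-fibres (c i) (c j) eq | clique i j i≢j
  ...   | inj₁ ci≡cj | (ci≢cj , _)  = ⊥-elim (ci≢cj ci≡cj)
  ...   | inj₂ joins | (_ , ¬joins) = ⊥-elim (¬joins joins)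

module HensonEmbedding {n : ℕ} {G : Graph} (H : IsHenson n G)
                       (F : FinGraph) (F-free : ¬ HasClique n F) where

  φ : EmbedsInto F G
  φ = Equivalence.from (proj₂ (proj₂ H) F) F-free

  embed : Fin (size F) → V G
  embed = proj₁ φ

  distinct : ∀ {i j} → i ≢ j → embed i ≢ embed j
  distinct i≢j φi≡φj = i≢j (proj₁ (proj₂ φ) φi≡φj)

  edge : ∀ {i j} → R F i j → E G (embed i) (embed j)
  edge {i} {j} = Equivalence.to (proj₂ (proj₂ φ) i j)

  nonedge : ∀ {i j} → i ≢ j → ¬ R F i j → N G (embed i) (embed j)
  nonedge {i} {j} i≢j ¬ij =
    (λ e → ¬ij (Equivalence.from (proj₂ (proj₂ φ) i j) e)) , distinct i≢j

Henson-cliqueFree : ∀ {n G} → IsHenson n G → (h : Fin n → V G) → ¬ IsClique G h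
Henson-cliqueFree {n} {G} (_ , _ , embeds⇔free) h clique =
  Equivalence.to (embeds⇔free (complete n))
    (h , clique⇒injective G clique , λ i j → mk⇔ (clique i j) adjacent⇒distinct)
    (complete-hasClique n)
  where
  adjacent⇒distinct : ∀ {i j} → E G (h i) (h j) → i ≢ j
  adjacent⇒distinct e refl = E-irr G e

module _ {m : ℕ} where

  swap₀₂ : Fin (3 + m) → Fin (3 + m)
  swap₀₂ zero             = suc (suc zero)
  swap₀₂ (suc (suc zero)) = zero
  swap₀₂ i                = i

  swap₁₂ : Fin (3 + m) → Fin (3 + m)
  swap₁₂ (suc zero)       = suc (suc zero)
  swap₁₂ (suc (suc zero)) = suc zero
  swap₁₂ i                = i

  swap₀₂-involutive : ∀ i → swap₀₂ (swap₀₂ i) ≡ i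
  swap₀₂-involutive zero                = refl
  swap₀₂-involutive (suc zero)          = refl
  swap₀₂-involutive (suc (suc zero))    = refl
  swap₀₂-involutive (suc (suc (suc _))) = refl

  swap₁₂-involutive : ∀ i → swap₁₂ (swap₁₂ i) ≡ i
  swap₁₂-involutive zero                = refl
  swap₁₂-involutive (suc zero)          = refl
  swap₁₂-involutive (suc (suc zero))    = refl
  swap₁₂-involutive (suc (suc (suc _))) = refl

  swap₀₂-injective : Injective _≡_ _≡_ swap₀₂
  swap₀₂-injective =
    inverseʳ⇒injective swap₀₂ (strictlyInverseʳ⇒inverseʳ {f⁻¹ = swap₀₂} swap₀₂ swap₀₂-involutive)

  swap₁₂-injective : Injective _≡_ _≡_ swap₁₂
  swap₁₂-injective =
    inverseʳ⇒injective swap₁₂ (strictlyInverseʳ⇒inverseʳ {f⁻¹ = swap₁₂} swap₁₂ swap₁₂-involutive)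

  -- (0 2) and (1 2) pull the pair {0,1} back to {1,2} and {0,2} respectively.
  Joins₀₁-under-at-most-one-swap : ∀ (i j : Fin (3 + m)) →
    AtLeastTwo (¬ Joins₀₁ i j) (¬ Joins₀₁ (swap₀₂ i) (swap₀₂ j)) (¬ Joins₀₁ (swap₁₂ i) (swap₁₂ j))
  Joins₀₁-under-at-most-one-swap zero             zero                = inj₁ ((λ ()) , (λ ()))
  Joins₀₁-under-at-most-one-swap zero             (suc zero)          = inj₂ (inj₂ ((λ ()) , (λ ())))
  Joins₀₁-under-at-most-one-swap zero             (suc (suc zero))    = inj₁ ((λ ()) , (λ ()))
  Joins₀₁-under-at-most-one-swap zero             (suc (suc (suc _))) = inj₁ ((λ ()) , (λ ()))
  Joins₀₁-under-at-most-one-swap (suc zero)       zero                = inj₂ (inj₂ ((λ ()) , (λ ())))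
  Joins₀₁-under-at-most-one-swap (suc zero)       (suc zero)          = inj₁ ((λ ()) , (λ ()))
  Joins₀₁-under-at-most-one-swap (suc zero)       (suc (suc zero))    = inj₂ (inj₁ ((λ ()) , (λ ())))
  Joins₀₁-under-at-most-one-swap (suc zero)       (suc (suc (suc _))) = inj₁ ((λ ()) , (λ ()))
  Joins₀₁-under-at-most-one-swap (suc (suc zero)) zero                = inj₁ ((λ ()) , (λ ()))
  Joins₀₁-under-at-most-one-swap (suc (suc zero)) (suc zero)          = inj₂ (inj₁ ((λ ()) , (λ ())))
  Joins₀₁-under-at-most-one-swap (suc (suc zero)) (suc (suc zero))    = inj₁ ((λ ()) , (λ ()))
  Joins₀₁-under-at-most-one-swap (suc (suc zero)) (suc (suc (suc _))) = inj₁ ((λ ()) , (λ ()))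
  Joins₀₁-under-at-most-one-swap (suc (suc (suc _))) _                = inj₁ ((λ ()) , (λ ()))

  module _ {G : Graph} (H : IsHenson (3 + m) G) (f : Ternary G) where

    Henson-¬majority : ¬ Majority G f
    Henson-¬majority majority = Henson-cliqueFree H h h-clique
      where
      open HensonEmbedding H (co-single-edge (3 + m)) (co-single-edge-cliqueFree (1 + m))

      h : Fin (3 + m) → V G
      h i = f (embed i) (embed (swap₀₂ i)) (embed (swap₁₂ i))

      h-clique : IsClique G h
      h-clique i j i≢j =
        Equivalence.from (majority _ _ _ _ _ _ (distinct i≢j) (distinct ≢₀₂) (distinct ≢₁₂))
          (AtLeastTwo-map (edge ∘ (i≢j ,_)) (edge ∘ (≢₀₂ ,_)) (edge ∘ (≢₁₂ ,_))
            (Joins₀₁-under-at-most-one-swap i j))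
        where
        ≢₀₂ : swap₀₂ i ≢ swap₀₂ j
        ≢₀₂ eq = i≢j (swap₀₂-injective eq)
        ≢₁₂ : swap₁₂ i ≢ swap₁₂ j
        ≢₁₂ eq = i≢j (swap₁₂-injective eq)

    Henson-¬NNE∧ENN : TypeCond G f (N G) (N G) (E G) (E G) →
                      ¬ TypeCond G f (E G) (N G) (N G) (E G)
    Henson-¬NNE∧ENN NNE→E ENN→E = Henson-cliqueFree H h h-clique
      where
      module φ₀ = HensonEmbedding H (co-single-edge (3 + m))
                                    (co-single-edge-cliqueFree (1 + m))
      module φ₁ = HensonEmbedding H (single-edge (3 + m)) single-edge-triangleFree
      module φ₂ = HensonEmbedding H (edgeless (3 + m)) edgeless-cliqueFree

      h : Fin (3 + m) → V G
      h i = f (φ₁.embed i) (φ₂.embed i) (φ₀.embed i)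

      h-clique : IsClique G h
      h-clique i j i≢j with Joins₀₁? i j
      ... | yes joins = ENN→E _ _ _ _ _ _
        (φ₁.edge joins)
        (φ₂.nonedge i≢j λ ())
        (φ₀.nonedge i≢j λ (_ , ¬joins) → ¬joins joins)
      ... | no ¬joins = NNE→E _ _ _ _ _ _
        (φ₁.nonedge i≢j ¬joins)
        (φ₂.nonedge i≢j λ ())
        (φ₀.edge (i≢j , ¬joins))

lemma3p10 : (n : ℕ) → n ≥ 3 → (G : Graph) → IsHenson n G →
    (¬ Σ (Ternary G) (λ f → Injective3 G f × Majority G f))
    × (¬ Σ (Ternary G) (λ f → TypeCond G f (N G) (N G) (E G) (E G)
                              × TypeCond G f (E G) (N G) (N G) (E G)))
lemma3p10 _ (s≤s (s≤s (s≤s _))) G H =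
  (λ (f , _ , majority) → Henson-¬majority H f majority) ,
  (λ (f , NNE→E , ENN→E) → Henson-¬NNE∧ENN H f NNE→E ENN→E)
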